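{- Let $p,q$ be sets of cells such that $f(p)=q$, where $f(x,y)=(x-y,y)$ is the row shift. Then $p$ is an instance of the square tetromino if and only if $q$ is an instance of the Z tetromino.
   Context: Cells are the unit squares of the square lattice, indexed by integer coordinates $(x,y)$. The row shift is the map $f:\mathbb Z^2\to\mathbb Z^2$, $f(x,y)=(x-y,y)$, applied to sets of cells elementwise: $f(S)=\{f(c):c\in S\}$. An instance of the square tetromino is a set of the form $\{(m,n),(m+1,n),(m,n-1),(m+1,n-1)\}$ for integers $m,n$; an instance of the Z tetromino is a set of the form $\{(x,y),(x+1,y),(x+1,y-1),(x+2,y-1)\}$ for integers $x,y$. -}

module Defs where

open import Level using (0ℓ)
open import Data.Integer using (ℤ; _+_; _-_; 1ℤ)
open import Data.Product using (_×_; _,_; ∃; ∃-syntax; Σ-syntax)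
open import Data.Sum using (_⊎_)
open import Relation.Unary using (Pred; _≐_)
open import Relation.Binary.PropositionalEquality using (_≡_)

Cell : Set
Cell = ℤ × ℤ

CellSet : Set₁
CellSet = Pred Cell 0ℓ

rowShift : Cell → Cell
rowShift (x , y) = (x - y , y)

image : (Cell → Cell) → CellSet → CellSet
image g S c = ∃[ d ] (S d × g d ≡ c)

four : Cell → Cell → Cell → Cell → CellSet
four a b c d e = (e ≡ a ⊎ e ≡ b) ⊎ (e ≡ c ⊎ e ≡ d)

squareTet : ℤ → ℤ → CellSet
squareTet m n = four (m , n) (m + 1ℤ , n) (m , n - 1ℤ) (m + 1ℤ , n - 1ℤ)

zTet : ℤ → ℤ → CellSet
zTet x y = four (x , y) (x + 1ℤ , y) (x + 1ℤ , y - 1ℤ) ((x + 1ℤ) + 1ℤ , y - 1ℤ)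

IsSquareInstance : CellSet → Set
IsSquareInstance S = ∃[ m ] ∃[ n ] (S ≐ squareTet m n)

IsZInstance : CellSet → Set
IsZInstance S = ∃[ x ] ∃[ y ] (S ≐ zTet x y)

{-# OPTIONS --safe #-}
-- The row shift is injective, so taking images under it reflects as well as preserves
-- set equality, and it carries the four cells of the square at (m , n) onto the four
-- cells of the Z tetromino at (m - n , n): the lower row is shifted one step further
-- right than the upper one.
module Submission where

open import Defs
open import Data.Integer using (_+_; _-_; -_; 1ℤ)
open import Data.Integer.Properties using (+-0-abelianGroup)
open import Algebra.Properties.AbelianGroup +-0-abelianGroup using (∙-cancelʳ)
open import Data.Integer.Tactic.RingSolver using (solve-∀)
open import Data.Product using (_,_; proj₁; proj₂)
open import Data.Sum using (inj₁; inj₂)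
open import Function.Bundles using (_⇔_; mk⇔)
open import Function.Definitions using (Injective)
open import Relation.Binary.PropositionalEquality using (_≡_; refl; cong; subst)
open import Relation.Unary using (_≐_)
open import Relation.Unary.Properties using (≐-refl; ≐-sym; ≐-trans)

image-resp-≐ : ∀ g {S T} → S ≐ T → image g S ≐ image g T
image-resp-≐ g (S⊆T , T⊆S) =
  (λ (d , Sd , gd≡c) → d , S⊆T Sd , gd≡c) , (λ (d , Td , gd≡c) → d , T⊆S Td , gd≡c)

image-reflects-⊆ : ∀ {g} → Injective _≡_ _≡_ g → ∀ {S T} →
                   (∀ {c} → image g S c → image g T c) → ∀ {c} → S c → T c
image-reflects-⊆ g-inj gS⊆gT Sc with gS⊆gT (_ , Sc , refl)
... | d , Td , gd≡gc = subst _ (g-inj gd≡gc) Td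

image-reflects-≐ : ∀ {g} → Injective _≡_ _≡_ g → ∀ {S T} → image g S ≐ image g T → S ≐ T
image-reflects-≐ g-inj (gS⊆gT , gT⊆gS) =
  image-reflects-⊆ g-inj gS⊆gT , image-reflects-⊆ g-inj gT⊆gS

image-four : ∀ g a b c d → image g (four a b c d) ≐ four (g a) (g b) (g c) (g d)
image-four g a b c d = to , from
  where
  to : ∀ {e} → image g (four a b c d) e → four (g a) (g b) (g c) (g d) e
  to (_ , inj₁ (inj₁ refl) , refl) = inj₁ (inj₁ refl)
  to (_ , inj₁ (inj₂ refl) , refl) = inj₁ (inj₂ refl)
  to (_ , inj₂ (inj₁ refl) , refl) = inj₂ (inj₁ refl)
  to (_ , inj₂ (inj₂ refl) , refl) = inj₂ (inj₂ refl)

  from : ∀ {e} → four (g a) (g b) (g c) (g d) e → image g (four a b c d) e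
  from (inj₁ (inj₁ refl)) = a , inj₁ (inj₁ refl) , refl
  from (inj₁ (inj₂ refl)) = b , inj₁ (inj₂ refl) , refl
  from (inj₂ (inj₁ refl)) = c , inj₂ (inj₁ refl) , refl
  from (inj₂ (inj₂ refl)) = d , inj₂ (inj₂ refl) , refl

four-cong : ∀ {a a′ b b′ c c′ d d′} → a ≡ a′ → b ≡ b′ → c ≡ c′ → d ≡ d′ →
            four a b c d ≐ four a′ b′ c′ d′
four-cong refl refl refl refl = ≐-refl

rowShift-injective : Injective _≡_ _≡_ rowShift
rowShift-injective {a , b} {a′ , b′} shift≡ with cong proj₂ shift≡
... | refl = cong (_, b) (∙-cancelʳ (- b) a a′ (cong proj₁ shift≡))

image-rowShift-squareTet : ∀ m n → image rowShift (squareTet m n) ≐ zTet (m - n) n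
image-rowShift-squareTet m n =
  ≐-trans (image-four rowShift _ _ _ _)
          (four-cong refl (cong (_, n) (shift-right m n))
                     (cong (_, n - 1ℤ) (shift-down m n))
                     (cong (_, n - 1ℤ) (shift-down-right m n)))
  where
  shift-right : ∀ m n → (m + 1ℤ) - n ≡ (m - n) + 1ℤ
  shift-right = solve-∀
  shift-down : ∀ m n → m - (n - 1ℤ) ≡ (m - n) + 1ℤ
  shift-down = solve-∀
  shift-down-right : ∀ m n → (m + 1ℤ) - (n - 1ℤ) ≡ ((m - n) + 1ℤ) + 1ℤ
  shift-down-right = solve-∀

image-rowShift-squareTet-+ : ∀ x y → image rowShift (squareTet (x + y) y) ≐ zTet x y
image-rowShift-squareTet-+ x y =
  subst (λ k → image rowShift (squareTet (x + y) y) ≐ zTet k y) (x+y-y≡x x y)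
        (image-rowShift-squareTet (x + y) y)
  where
  x+y-y≡x : ∀ x y → (x + y) - y ≡ x
  x+y-y≡x = solve-∀

lemma6p1 : (p q : CellSet) → image rowShift p ≐ q →
    (IsSquareInstance p ⇔ IsZInstance q)
lemma6p1 p q fp≐q = mk⇔ to from
  where
  to : IsSquareInstance p → IsZInstance q
  to (m , n , p≐□) = m - n , n ,
    ≐-trans (≐-sym fp≐q) (≐-trans (image-resp-≐ rowShift p≐□) (image-rowShift-squareTet m n))

  from : IsZInstance q → IsSquareInstance p
  from (x , y , q≐Z) = x + y , y , image-reflects-≐ rowShift-injective
    (≐-trans fp≐q (≐-trans q≐Z (≐-sym (image-rowShift-squareTet-+ x y))))
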